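{- Let $k\ge1$ and let $u,v,v'$ be non-empty words over $\{0,1\}$ with $|v|=|v'|$. Then $\varphi^{k-1}(u)\,\varphi^k(v)\sim_k\varphi^k(v')\,\varphi^{k-1}(u)$.
   Context: $\varphi(0)=01$, $\varphi(1)=10$. $\binom{x}{y}$ is the number of occurrences of $y$ as a subword (subsequence) of $x$; $x\sim_k y$ means $\binom{x}{z}=\binom{y}{z}$ for all words $z$ of length at most $k$. -}

module Defs where

open import Data.Bool using (Bool; true; false; _≟_)
open import Relation.Nullary using (yes; no)
open import Data.Nat using (ℕ; zero; suc; _+_; _≤_)
open import Data.List using (List; []; _∷_; _++_; concatMap; length)
open import Relation.Binary.PropositionalEquality using (_≡_)

-- Binary words: letters 0 and 1 are represented by false and true.
Word : Set
Word = List Bool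

φ₁ : Bool → Word
φ₁ false = false ∷ true ∷ []
φ₁ true  = true ∷ false ∷ []

φ : Word → Word
φ = concatMap φ₁

φ^ : ℕ → Word → Word
φ^ zero    w = w
φ^ (suc k) w = φ (φ^ k w)

-- Binomial coefficient of words: number of occurrences of y as a
-- (scattered) subword of x.
binom : Word → Word → ℕ
binom x       []      = 1
binom []      (_ ∷ _) = 0
binom (a ∷ x) (b ∷ y) with a ≟ b
... | yes _ = binom x (b ∷ y) + binom x y
... | no  _ = binom x (b ∷ y)

_∼[_]_ : Word → ℕ → Word → Set
x ∼[ k ] y = ∀ (z : Word) → length z ≤ k → binom x z ≡ binom y z

-- An occurrence of z in x ++ y lies in x, lies in y, or splits z = s t with
-- s, t non-empty and counts binom x s * binom y t.  For |z| ≤ k + 1 the last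
-- ("cross") part only involves subwords of length ≤ k, so it is invariant
-- under replacing x and y by k-binomially equivalent words.  Hence x ++ y and
-- y ++ x are (k+1)-equivalent as soon as some k-equivalent pair x′, y′ has
-- this property; in particular whenever x ∼ₖ y.  For φ this yields
-- φᵏ(a) ∼ₖ φᵏ(b) for letters a, b (as φᵏ⁺¹(0) = φᵏ(0)φᵏ(1) and
-- φᵏ⁺¹(1) = φᵏ(1)φᵏ(0)), hence φᵏ(v) ∼ₖ φᵏ(v′) for |v| = |v′|; and φʲ(u),
-- φʲ(w) are j-equivalent to images of powers of 0, which commute, so
-- φʲ(u)φʲ(w) ∼ⱼ₊₁ φʲ(w)φʲ(u).  Take j = k - 1 and w = φ(v).
module Submission where

open import Defs
open import Data.Nat using (ℕ; _≤_; _∸_)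
open import Data.List using (List; []; _++_; length)
open import Relation.Binary.PropositionalEquality using (_≡_; _≢_)

open import Data.Bool using (Bool; true; false) renaming (_≟_ to _≟ᵇ_)
open import Data.Nat using (zero; suc; _+_; _*_; s≤s)
open import Data.Nat.Properties
  using (+-comm; +-assoc; +-identityʳ; *-identityˡ; *-zeroʳ; +-cancelˡ-≡; ≤-trans; n≤1+n; suc-injective)
open import Data.Nat.Tactic.RingSolver using (solve-∀)
open import Data.List using (_∷_; map; concat; replicate)
open import Data.List.Properties
  using (++-assoc; map-++; concat-++; length-replicate; length-++-≤ˡ; length-++-≤ʳ; length-++-sucʳ)
open import Relation.Nullary using (yes; no)
open import Relation.Binary.PropositionalEquality
  using (refl; sym; trans; cong; cong₂; subst; subst₂; module ≡-Reasoning)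

open ≡-Reasoning

δ : Bool → Bool → ℕ
δ a c with a ≟ᵇ c
... | yes _ = 1
... | no  _ = 0

binom-∷ : ∀ a x c p → binom (a ∷ x) (c ∷ p) ≡ δ a c * binom x p + binom x (c ∷ p)
binom-∷ a x c p with a ≟ᵇ c
... | yes _ rewrite *-identityˡ (binom x p) = +-comm (binom x (c ∷ p)) (binom x p)
... | no  _ = refl

-- splitSum x y p z = Σ { binom x (p ++ s) * binom y t | z = s ++ t, t ≢ [] }
splitSum : Word → Word → Word → Word → ℕ
splitSum x y p []      = 0
splitSum x y p (d ∷ z) = binom x p * binom y (d ∷ z) + splitSum x y (p ++ d ∷ []) z

cross : Word → Word → Bool → Word → ℕ
cross x y c z = splitSum x y (c ∷ []) z

splitSum-∷ : ∀ a x y c p z →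
  splitSum (a ∷ x) y (c ∷ p) z ≡ δ a c * splitSum x y p z + splitSum x y (c ∷ p) z
splitSum-∷ a x y c p []      = sym (trans (+-identityʳ _) (*-zeroʳ (δ a c)))
splitSum-∷ a x y c p (d ∷ z)
  rewrite binom-∷ a x c p | splitSum-∷ a x y c (p ++ d ∷ []) z =
  distrib (δ a c) (binom x p) (binom x (c ∷ p)) (binom y (d ∷ z))
    (splitSum x y (p ++ d ∷ []) z) (splitSum x y (c ∷ p ++ d ∷ []) z)
  where
  distrib : ∀ i u v B U V → (i * u + v) * B + (i * U + V) ≡ i * (u * B + U) + (v * B + V)
  distrib = solve-∀

splitSum-[]ˡ : ∀ y c p z → splitSum [] y (c ∷ p) z ≡ 0
splitSum-[]ˡ y c p []      = refl
splitSum-[]ˡ y c p (d ∷ z) = splitSum-[]ˡ y c (p ++ d ∷ []) z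

binom-++ : ∀ x y z → binom (x ++ y) z ≡ binom x z + splitSum x y [] z
binom-++ []      y []      = refl
binom-++ []      y (c ∷ z) rewrite splitSum-[]ˡ y c [] z | +-identityʳ (binom y (c ∷ z)) =
  sym (*-identityˡ (binom y (c ∷ z)))
binom-++ (a ∷ x) y []      = refl
binom-++ (a ∷ x) y (c ∷ z)
  rewrite binom-∷ a (x ++ y) c z | binom-++ x y z | binom-++ x y (c ∷ z)
        | binom-∷ a x c z | splitSum-∷ a x y c [] z =
  regroup (δ a c) (binom x z) (splitSum x y [] z) (binom x (c ∷ z))
    (binom y (c ∷ z)) (cross x y c z)
  where
  regroup : ∀ i X S X′ B T → i * (X + S) + (X′ + (1 * B + T)) ≡ (i * X + X′) + (1 * B + (i * S + T))
  regroup = solve-∀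

binom-++-∷ : ∀ x y c z → binom (x ++ y) (c ∷ z) ≡ binom x (c ∷ z) + binom y (c ∷ z) + cross x y c z
binom-++-∷ x y c z = begin
  binom (x ++ y) (c ∷ z)                                   ≡⟨ binom-++ x y (c ∷ z) ⟩
  binom x (c ∷ z) + (1 * binom y (c ∷ z) + cross x y c z)  ≡⟨ cong (λ n → binom x (c ∷ z) + (n + cross x y c z)) (*-identityˡ _) ⟩
  binom x (c ∷ z) + (binom y (c ∷ z) + cross x y c z)      ≡⟨ sym (+-assoc (binom x (c ∷ z)) _ _) ⟩
  binom x (c ∷ z) + binom y (c ∷ z) + cross x y c z        ∎

∼-refl : ∀ {k} x → x ∼[ k ] x
∼-refl x z _ = refl

∼-sym : ∀ {k x y} → x ∼[ k ] y → y ∼[ k ] x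
∼-sym x∼y z |z|≤k = sym (x∼y z |z|≤k)

∼-trans : ∀ {k x y w} → x ∼[ k ] y → y ∼[ k ] w → x ∼[ k ] w
∼-trans x∼y y∼w z |z|≤k = trans (x∼y z |z|≤k) (y∼w z |z|≤k)

≡⇒∼ : ∀ {k x y} → x ≡ y → x ∼[ k ] y
≡⇒∼ refl = ∼-refl _

module _ {k : ℕ} {x x′ y y′ : Word} (x∼x′ : x ∼[ k ] x′) (y∼y′ : y ∼[ k ] y′) where

  splitSum-cong : ∀ c p z → length (p ++ z) ≤ k → splitSum x y (c ∷ p) z ≡ splitSum x′ y′ (c ∷ p) z
  splitSum-cong c p []      _        = refl
  splitSum-cong c p (d ∷ z) |pdz|≤k =
    cong₂ _+_ (cong₂ _*_ (x∼x′ (c ∷ p) |cp|≤k) (y∼y′ (d ∷ z) |dz|≤k))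
              (splitSum-cong c (p ++ d ∷ []) z |pd++z|≤k)
    where
    |cp|≤k : length (c ∷ p) ≤ k
    |cp|≤k = ≤-trans (s≤s (length-++-≤ˡ p)) (subst (_≤ k) (length-++-sucʳ p d z) |pdz|≤k)
    |dz|≤k : length (d ∷ z) ≤ k
    |dz|≤k = ≤-trans (length-++-≤ʳ (d ∷ z) {p}) |pdz|≤k
    |pd++z|≤k : length ((p ++ d ∷ []) ++ z) ≤ k
    |pd++z|≤k = subst (λ w → length w ≤ k) (sym (++-assoc p (d ∷ []) z)) |pdz|≤k

  cross-cong : ∀ c z → length z ≤ k → cross x y c z ≡ cross x′ y′ c z
  cross-cong c = splitSum-cong c []

  ∼-++ : (x ++ y) ∼[ k ] (x′ ++ y′)
  ∼-++ []      _          = refl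
  ∼-++ (c ∷ z) |cz|≤k = begin
    binom (x ++ y) (c ∷ z)                               ≡⟨ binom-++-∷ x y c z ⟩
    binom x (c ∷ z) + binom y (c ∷ z) + cross x y c z    ≡⟨ cong₂ _+_ (cong₂ _+_ (x∼x′ (c ∷ z) |cz|≤k) (y∼y′ (c ∷ z) |cz|≤k))
                                                                      (cross-cong c z (≤-trans (n≤1+n _) |cz|≤k)) ⟩
    binom x′ (c ∷ z) + binom y′ (c ∷ z) + cross x′ y′ c z ≡⟨ sym (binom-++-∷ x′ y′ c z) ⟩
    binom (x′ ++ y′) (c ∷ z)                             ∎

module _ {k : ℕ} {x y : Word} where

  CrossCommute : Set
  CrossCommute = ∀ c z → length z ≤ k → cross x y c z ≡ cross y x c z

  ++-comm⇒cross-comm : (x ++ y) ∼[ suc k ] (y ++ x) → CrossCommute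
  ++-comm⇒cross-comm xy∼yx c z |z|≤k = +-cancelˡ-≡ (binom x (c ∷ z) + binom y (c ∷ z)) _ _ (begin
    binom x (c ∷ z) + binom y (c ∷ z) + cross x y c z ≡⟨ sym (binom-++-∷ x y c z) ⟩
    binom (x ++ y) (c ∷ z)                            ≡⟨ xy∼yx (c ∷ z) (s≤s |z|≤k) ⟩
    binom (y ++ x) (c ∷ z)                            ≡⟨ binom-++-∷ y x c z ⟩
    binom y (c ∷ z) + binom x (c ∷ z) + cross y x c z ≡⟨ cong (_+ cross y x c z) (+-comm (binom y (c ∷ z)) _) ⟩
    binom x (c ∷ z) + binom y (c ∷ z) + cross y x c z ∎)

  cross-comm⇒++-comm : CrossCommute → (x ++ y) ∼[ suc k ] (y ++ x)
  cross-comm⇒++-comm _     []      _            = refl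
  cross-comm⇒++-comm cross≡ (c ∷ z) (s≤s |z|≤k) = begin
    binom (x ++ y) (c ∷ z)                            ≡⟨ binom-++-∷ x y c z ⟩
    binom x (c ∷ z) + binom y (c ∷ z) + cross x y c z ≡⟨ cong₂ _+_ (+-comm (binom x (c ∷ z)) _) (cross≡ c z |z|≤k) ⟩
    binom y (c ∷ z) + binom x (c ∷ z) + cross y x c z ≡⟨ sym (binom-++-∷ y x c z) ⟩
    binom (y ++ x) (c ∷ z)                            ∎

++-comm-transfer : ∀ {k x x′ y y′} → x ∼[ k ] x′ → y ∼[ k ] y′ →
  (x′ ++ y′) ∼[ suc k ] (y′ ++ x′) → (x ++ y) ∼[ suc k ] (y ++ x)
++-comm-transfer {x = x} {x′} {y} {y′} x∼x′ y∼y′ x′y′∼y′x′ = cross-comm⇒++-comm λ c z |z|≤k → begin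
  cross x y c z   ≡⟨ cross-cong x∼x′ y∼y′ c z |z|≤k ⟩
  cross x′ y′ c z ≡⟨ ++-comm⇒cross-comm x′y′∼y′x′ c z |z|≤k ⟩
  cross y′ x′ c z ≡⟨ sym (cross-cong y∼y′ x∼x′ c z |z|≤k) ⟩
  cross y x c z   ∎

∼⇒++-comm : ∀ {k x y} → x ∼[ k ] y → (x ++ y) ∼[ suc k ] (y ++ x)
∼⇒++-comm {y = y} x∼y = ++-comm-transfer x∼y (∼-refl y) (∼-refl (y ++ y))

replicate-++ : ∀ {A : Set} m n (a : A) → replicate m a ++ replicate n a ≡ replicate (m + n) a
replicate-++ zero    n a = refl
replicate-++ (suc m) n a = cong (a ∷_) (replicate-++ m n a)

replicate-++-comm : ∀ {A : Set} m n (a : A) → replicate m a ++ replicate n a ≡ replicate n a ++ replicate m a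
replicate-++-comm m n a = begin
  replicate m a ++ replicate n a ≡⟨ replicate-++ m n a ⟩
  replicate (m + n) a            ≡⟨ cong (λ l → replicate l a) (+-comm m n) ⟩
  replicate (n + m) a            ≡⟨ sym (replicate-++ n m a) ⟩
  replicate n a ++ replicate m a ∎

φ-++ : ∀ x y → φ (x ++ y) ≡ φ x ++ φ y
φ-++ x y = trans (cong concat (map-++ φ₁ x y)) (sym (concat-++ (map φ₁ x) (map φ₁ y)))

φ^-++ : ∀ k x y → φ^ k (x ++ y) ≡ φ^ k x ++ φ^ k y
φ^-++ zero    x y = refl
φ^-++ (suc k) x y = trans (cong φ (φ^-++ k x y)) (φ-++ (φ^ k x) (φ^ k y))

φ^-suc : ∀ k w → φ^ (suc k) w ≡ φ^ k (φ w)
φ^-suc zero    w = refl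
φ^-suc (suc k) w = cong φ (φ^-suc k w)

φ^-comm : ∀ k x y → x ++ y ≡ y ++ x → φ^ k x ++ φ^ k y ≡ φ^ k y ++ φ^ k x
φ^-comm k x y xy≡yx = begin
  φ^ k x ++ φ^ k y ≡⟨ sym (φ^-++ k x y) ⟩
  φ^ k (x ++ y)    ≡⟨ cong (φ^ k) xy≡yx ⟩
  φ^ k (y ++ x)    ≡⟨ φ^-++ k y x ⟩
  φ^ k y ++ φ^ k x ∎

φ^-false∼true : ∀ k → φ^ k (false ∷ []) ∼[ k ] φ^ k (true ∷ [])
φ^-false∼true zero    []      _  = refl
φ^-false∼true zero    (_ ∷ _) ()
φ^-false∼true (suc k) =
  subst₂ _∼[ suc k ]_ (sym (unfold false true refl)) (sym (unfold true false refl))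
    (∼⇒++-comm (φ^-false∼true k))
  where
  unfold : ∀ a b → φ (a ∷ []) ≡ a ∷ b ∷ [] → φ^ (suc k) (a ∷ []) ≡ φ^ k (a ∷ []) ++ φ^ k (b ∷ [])
  unfold a b φa≡ab = trans (φ^-suc k (a ∷ [])) (trans (cong (φ^ k) φa≡ab) (φ^-++ k (a ∷ []) (b ∷ [])))

φ^-letter-∼ : ∀ k a b → φ^ k (a ∷ []) ∼[ k ] φ^ k (b ∷ [])
φ^-letter-∼ k false false = ∼-refl _
φ^-letter-∼ k true  true  = ∼-refl _
φ^-letter-∼ k false true  = φ^-false∼true k
φ^-letter-∼ k true  false = ∼-sym (φ^-false∼true k)

φ^-∼ : ∀ k v v′ → length v ≡ length v′ → φ^ k v ∼[ k ] φ^ k v′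
φ^-∼ k []      []       _      = ∼-refl _
φ^-∼ k (a ∷ v) (b ∷ v′) |v|≡|v′| =
  subst₂ _∼[ k ]_ (sym (φ^-++ k (a ∷ []) v)) (sym (φ^-++ k (b ∷ []) v′))
    (∼-++ (φ^-letter-∼ k a b) (φ^-∼ k v v′ (suc-injective |v|≡|v′|)))

φ^-++-comm : ∀ k u w → (φ^ k u ++ φ^ k w) ∼[ suc k ] (φ^ k w ++ φ^ k u)
φ^-++-comm k u w =
  ++-comm-transfer (φ^-∼ k u 0ᵘ (sym (length-replicate _))) (φ^-∼ k w 0ʷ (sym (length-replicate _)))
    (≡⇒∼ (φ^-comm k 0ᵘ 0ʷ (replicate-++-comm (length u) (length w) false)))
  where
  0ᵘ 0ʷ : Word
  0ᵘ = replicate (length u) false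
  0ʷ = replicate (length w) false

lemma4p6 : (k : ℕ) → 1 ≤ k → (u v v′ : Word)
    → u ≢ [] → v ≢ [] → v′ ≢ []
    → length v ≡ length v′
    → (φ^ (k ∸ 1) u ++ φ^ k v) ∼[ k ] (φ^ k v′ ++ φ^ (k ∸ 1) u)
lemma4p6 (suc j) _ u v v′ _ _ _ |v|≡|v′| =
  ∼-trans (subst₂ _∼[ suc j ]_ (cong (φ^ j u ++_) φⱼφv≡φʲ⁺¹v) (cong (_++ φ^ j u) φⱼφv≡φʲ⁺¹v)
             (φ^-++-comm j u (φ v)))
          (∼-++ (φ^-∼ (suc j) v v′ |v|≡|v′|) (∼-refl (φ^ j u)))
  where
  φⱼφv≡φʲ⁺¹v : φ^ j (φ v) ≡ φ^ (suc j) v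
  φⱼφv≡φʲ⁺¹v = sym (φ^-suc j v)
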